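{- Let $f(a,b,c)\in\mathbb{Z}[a,b,c]$ and consider positive integer solutions $(a,b,c)$ of the Diophantine equation $a^{2}+b^{2}+c^{2}=abc\,f(a,b,c)$; for such a triple let $k:=\gcd(a,b,c)$. (1) For every $f\in\mathbb{Z}[a,b,c]$, there is no positive integer solution $(a,b,c)$ of $a^{2}+b^{2}+c^{2}=abc\,f(a,b,c)$ with $k\notin\{1,3\}$. (2) For every non-zero polynomial $g(a,b,c)\in\mathbb{Z}_{\geq 0}[a,b,c]$, the equation $a^{2}+b^{2}+c^{2}=abc\,(3+g(a,b,c))$ has no positive integer solution $(a,b,c)$ with $k=1$. (3) For every polynomial $g(a,b,c)\in\mathbb{Z}_{\geq 0}[a,b,c]$ with $g\neq 1$ (i.e. $g$ is not the constant polynomial $1$), the equation $a^{2}+b^{2}+c^{2}=abc\,g(a,b,c)$ has no positive integer solution $(a,b,c)$ with $k=3$.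
   Context: $\mathbb{Z}_{\geq 0}[a,b,c]$ denotes the set of polynomials in $a,b,c$ whose coefficients are non-negative integers. -}

module Defs where

open import Data.Nat as ℕ using (ℕ; zero; suc; _<_)
open import Data.Nat.GCD using (gcd)
open import Data.Integer as ℤ using (ℤ)
open import Data.List using (List; foldr; map; concatMap; upTo)
open import Data.Product using (_×_; ∃-syntax)
open import Relation.Binary.PropositionalEquality using (_≡_; _≢_)

-- Polynomials in three variables a, b, c, represented by their coefficient
-- function (i , j , l) ↦ coefficient of a^i b^j c^l, together with a bound
-- on the support (so that only finitely many coefficients are non-zero).
-- Two polynomials are equal iff their coefficient functions agree pointwise.

record ZPoly : Set where
  field
    bound   : ℕ
    coeff   : ℕ → ℕ → ℕ → ℤ
    support : ∀ i j l → coeff i j l ≢ ℤ.+ 0 → i < bound × j < bound × l < bound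
open ZPoly public

record NPoly : Set where
  field
    boundN   : ℕ
    coeffN   : ℕ → ℕ → ℕ → ℕ
    supportN : ∀ i j l → coeffN i j l ≢ 0 → i < boundN × j < boundN × l < boundN
open NPoly public

sumℤ : List ℤ → ℤ
sumℤ = foldr ℤ._+_ (ℤ.+ 0)

sumℕ : List ℕ → ℕ
sumℕ = foldr ℕ._+_ 0

evalZ : ZPoly → ℤ → ℤ → ℤ → ℤ
evalZ p a b c =
  sumℤ (concatMap (λ i → concatMap (λ j → map (λ l →
    coeff p i j l ℤ.* (a ℤ.^ i) ℤ.* (b ℤ.^ j) ℤ.* (c ℤ.^ l))
    (upTo (bound p))) (upTo (bound p))) (upTo (bound p)))

evalN : NPoly → ℕ → ℕ → ℕ → ℕ
evalN p a b c =
  sumℕ (concatMap (λ i → concatMap (λ j → map (λ l →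
    coeffN p i j l ℕ.* (a ℕ.^ i) ℕ.* (b ℕ.^ j) ℕ.* (c ℕ.^ l))
    (upTo (boundN p))) (upTo (boundN p))) (upTo (boundN p)))

NonZeroPoly : NPoly → Set
NonZeroPoly g = ∃[ i ] ∃[ j ] ∃[ l ] coeffN g i j l ≢ 0

one-coeff : ℕ → ℕ → ℕ → ℕ
one-coeff zero zero zero = 1
one-coeff _    _    _    = 0

IsOnePoly : NPoly → Set
IsOnePoly g = ∀ i j l → coeffN g i j l ≡ one-coeff i j l

gcd3 : ℕ → ℕ → ℕ → ℕ
gcd3 a b c = gcd (gcd a b) c

{-# OPTIONS --safe #-}
module Submission where

-- Everything rests on Hurwitz's theorem: x² + y² + z² = n x y z has positive
-- solutions only for n = 1 and n = 3.  For n ≥ 5, Vieta jumping in the largest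
-- coordinate strictly decreases x + y + z.  For even n all coordinates are even
-- (squares mod 4), and halving them doubles n, so n = 2 and n = 4 reduce to n = 8.
-- Dividing a solution of a² + b² + c² = abc·M by k = gcd(a,b,c) gives a solution
-- with n = kM, so k ∈ {1,3}.  For k = 1, n = 3 + g forces g(a,b,c) = 0 although g
-- is non-zero; for k = 3, n = 3g forces g(a,b,c) = 1 at a point with a, b, c ≥ 3,
-- which among polynomials with non-negative coefficients only the constant 1 does.

open import Defs
open import Data.Nat
open import Data.Nat.Properties
open import Algebra.Properties.CommutativeSemigroup +-commutativeSemigroup
  using (xy∙z≈xz∙y; xy∙z≈zx∙y)
open import Data.Nat.DivMod
  using (_%_; _/_; m≡m%n+[m/n]*n; m%n<n; [m+kn]%n≡m%n; m*n%n≡0; m∣n⇒o%n%m≡o%m)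
open import Data.Nat.Divisibility using (_∣_; divides; ∣-trans; ∣⇒≤; m%n≡0⇒n∣m)
open import Data.Nat.GCD using (gcd; gcd[m,n]∣m; gcd[m,n]∣n; gcd[m,n]≢0)
open import Data.Nat.Induction using (<-wellFounded)
open import Data.Nat.Primality using (prime?; prime⇒irreducible)
open import Data.Nat.Tactic.RingSolver using (solve-∀)
open import Data.Integer as ℤ using ()
open import Data.Integer.Properties using (+-injective; pos-*)
open import Data.List using (List; []; _∷_; map; concatMap; upTo)
open import Data.List.Membership.Propositional using (_∈_; lose)
open import Data.List.Membership.Propositional.Properties
  using (∈-map⁺; ∈-map⁻; ∈-concatMap⁺; ∈-concatMap⁻; ∈-upTo⁺)
open import Data.List.Relation.Unary.All as All using (All; []; _∷_)
open import Data.List.Relation.Unary.Any using (here; there; satisfied)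
open import Data.Product using (Σ-syntax; ∃-syntax; _×_; _,_)
open import Data.Sum using (_⊎_; inj₁; inj₂; [_,_])
open import Data.Empty using (⊥; ⊥-elim)
open import Induction.WellFounded using (Acc; acc)
open import Relation.Nullary using (¬_; yes; no; contradiction)
open import Relation.Nullary.Decidable using (from-yes)
open import Relation.Binary.PropositionalEquality
  using (_≡_; _≢_; refl; sym; trans; cong; cong₂; subst; subst₂; module ≡-Reasoning)

Hurwitz : ℕ → ℕ → ℕ → ℕ → Set
Hurwitz n x y z = x * x + y * y + z * z ≡ n * x * y * z

record PositiveSolution (n : ℕ) : Set where
  constructor solution
  field
    x y z  : ℕ
    x>0    : 0 < x
    y>0    : 0 < y
    z>0    : 0 < z
    solves : Hurwitz n x y z

private
  variable
    a b c k m n x y z M : ℕ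

m*n>0⇒m>0 : 0 < m * n → 0 < m
m*n>0⇒m>0 {suc m} _ = z<s

product>0 : 0 < x → 0 < y → 0 < z → 0 < x * y * z
product>0 x>0 y>0 z>0 = *-mono-≤ (*-mono-≤ x>0 y>0) z>0

size : PositiveSolution n → ℕ
size (solution x y z _ _ _ _) = x + y + z

Hurwitz-swap : Hurwitz n x y z → Hurwitz n x z y
Hurwitz-swap {n} {x} {y} {z} h = trans (lhs x y z) (trans h (rhs n x y z))
  where
  lhs : ∀ x y z → x * x + z * z + y * y ≡ x * x + y * y + z * z
  lhs = solve-∀
  rhs : ∀ n x y z → n * x * y * z ≡ n * x * z * y
  rhs = solve-∀

Hurwitz-rotate : Hurwitz n x y z → Hurwitz n y z x
Hurwitz-rotate {n} {x} {y} {z} h = trans (lhs x y z) (trans h (rhs n x y z))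
  where
  lhs : ∀ x y z → y * y + z * z + x * x ≡ x * x + y * y + z * z
  lhs = solve-∀
  rhs : ∀ n x y z → n * x * y * z ≡ n * y * z * x
  rhs = solve-∀

swap : PositiveSolution n → PositiveSolution n
swap {n} (solution x y z x>0 y>0 z>0 h) =
  solution x z y x>0 z>0 y>0 (Hurwitz-swap {n} {x} {y} {z} h)

rotate : PositiveSolution n → PositiveSolution n
rotate {n} (solution x y z x>0 y>0 z>0 h) =
  solution y z x y>0 z>0 x>0 (Hurwitz-rotate {n} {x} {y} {z} h)

size-swap : (s : PositiveSolution n) → size (swap s) ≡ size s
size-swap (solution x y z _ _ _ _) = xy∙z≈xz∙y x z y

size-rotate : (s : PositiveSolution n) → size (rotate s) ≡ size s
size-rotate (solution x y z _ _ _ _) = xy∙z≈zx∙y y z x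

LastLargest : PositiveSolution n → Set
LastLargest (solution x y z _ _ _ _) = x ≤ z × y ≤ z

largest-last : (s : PositiveSolution n) → Σ[ s' ∈ PositiveSolution n ] size s' ≡ size s × LastLargest s'
largest-last s@(solution x y z _ _ _ _) with ≤-total x z | ≤-total y z
... | inj₁ x≤z | inj₁ y≤z = s , refl , x≤z , y≤z
... | inj₁ x≤z | inj₂ z≤y = swap s , size-swap s , ≤-trans x≤z z≤y , z≤y
... | inj₂ z≤x | inj₁ y≤z = rotate s , size-rotate s , ≤-trans y≤z z≤x , z≤x
... | inj₂ z≤x | inj₂ z≤y with ≤-total x y
...   | inj₁ x≤y = swap s , size-swap s , x≤y , z≤y
...   | inj₂ y≤x = rotate s , size-rotate s , y≤x , z≤x

squares≤4xyz : 0 < x → 0 < y → x ≤ z → y ≤ z → z * z ≤ x * x + y * y →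
               x * x + y * y + z * z ≤ 4 * (x * y * z)
squares≤4xyz {x} {y} {z} x>0 y>0 x≤z y≤z z²≤ = begin
  x * x + y * y + z * z             ≤⟨ +-monoʳ-≤ (x * x + y * y) z²≤ ⟩
  (x * x + y * y) + (x * x + y * y) ≤⟨ +-mono-≤ x²+y²≤ x²+y²≤ ⟩
  (P + P) + (P + P)                 ≡⟨ four-times P ⟩
  4 * P                             ∎
  where
  open ≤-Reasoning
  P = x * y * z
  x²≤P : x * x ≤ P
  x²≤P = ≤-trans (*-monoʳ-≤ x (≤-trans x≤z (m≤n*m z y {{>-nonZero y>0}})))
                 (≤-reflexive (sym (*-assoc x y z)))
  y²≤P : y * y ≤ P
  y²≤P = ≤-trans (*-monoʳ-≤ y (≤-trans y≤z (m≤n*m z x {{>-nonZero x>0}})))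
                 (≤-reflexive (reorder y x z))
    where
    reorder : ∀ y x z → y * (x * z) ≡ x * y * z
    reorder = solve-∀
  x²+y²≤ : x * x + y * y ≤ P + P
  x²+y²≤ = +-mono-≤ x²≤P y²≤P
  four-times : ∀ P → (P + P) + (P + P) ≡ 4 * P
  four-times = solve-∀

Hurwitz-coefficient≤4 : 0 < x → 0 < y → 0 < z → x ≤ z → y ≤ z → z * z ≤ x * x + y * y →
                        Hurwitz n x y z → n ≤ 4
Hurwitz-coefficient≤4 {x} {y} {z} {n} x>0 y>0 z>0 x≤z y≤z z²≤ h =
  *-cancelʳ-≤ n 4 (x * y * z) {{>-nonZero (product>0 x>0 y>0 z>0)}} (begin
    n * (x * y * z)       ≡⟨ reassociate n x y z ⟩
    n * x * y * z         ≡⟨ h ⟨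
    x * x + y * y + z * z ≤⟨ squares≤4xyz x>0 y>0 x≤z y≤z z²≤ ⟩
    4 * (x * y * z)       ∎)
  where
  open ≤-Reasoning
  reassociate : ∀ n x y z → n * (x * y * z) ≡ n * x * y * z
  reassociate = solve-∀

-- z' = nxy − z is the other root of t² − nxy t + (x² + y²), so z z' = x² + y².
vieta-jump : 0 < x → 0 < y → Hurwitz n x y z → x * x + y * y < z * z →
             Σ[ z' ∈ ℕ ] 0 < z' × z' < z × Hurwitz n x y z'
vieta-jump {x} {y} {n} {z} x>0 y>0 h x²+y²<z² = z' , z'>0 , z'<z , h'
  where
  N = n * x * y
  x²+y²>0 : 0 < x * x + y * y
  x²+y²>0 = ≤-trans (*-mono-≤ x>0 x>0) (m≤m+n (x * x) (y * y))
  z<N : z < N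
  z<N = *-cancelʳ-< z z N (subst (z * z <_) h (m<n+m (z * z) x²+y²>0))
  z' = N ∸ z
  z'+z≡N : z' + z ≡ N
  z'+z≡N = m∸n+n≡m (<⇒≤ z<N)
  expand : ∀ u v → (u + v) * v ≡ u * v + v * v
  expand = solve-∀
  vieta-product : x * x + y * y ≡ z' * z
  vieta-product = +-cancelʳ-≡ (z * z) (x * x + y * y) (z' * z)
    (trans h (trans (cong (_* z) (sym z'+z≡N)) (expand z' z)))
  z'<z : z' < z
  z'<z = *-cancelʳ-< z z' z (subst (_< z * z) vieta-product x²+y²<z²)
  z'>0 : 0 < z'
  z'>0 = m*n>0⇒m>0 (subst (0 <_) vieta-product x²+y²>0)
  expand' : ∀ u v → u * v + u * u ≡ (u + v) * u
  expand' = solve-∀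
  h' : Hurwitz n x y z'
  h' = trans (cong (_+ z' * z') vieta-product) (trans (expand' z' z) (cong (_* z') z'+z≡N))

smaller-solution : 5 ≤ n → (s : PositiveSolution n) → Σ[ s' ∈ PositiveSolution n ] size s' < size s
smaller-solution {n} n≥5 s with largest-last s
... | solution x y z x>0 y>0 z>0 h , size≡ , x≤z , y≤z with z * z ≤? x * x + y * y
...   | yes z²≤ =
  contradiction (Hurwitz-coefficient≤4 {n = n} x>0 y>0 z>0 x≤z y≤z z²≤ h) (<⇒≱ n≥5)
...   | no z²≰ with vieta-jump {n = n} x>0 y>0 h (≰⇒> z²≰)
...     | z' , z'>0 , z'<z , h' =
  solution x y z' x>0 y>0 z'>0 h' , subst (x + y + z' <_) size≡ (+-monoʳ-< (x + y) z'<z)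

no-solution-≥5 : 5 ≤ n → ¬ PositiveSolution n
no-solution-≥5 {n} n≥5 s = descend s (<-wellFounded (size s))
  where
  descend : (s : PositiveSolution n) → Acc _<_ (size s) → ⊥
  descend s (acc smaller) with smaller-solution n≥5 s
  ... | s' , s'<s = descend s' (smaller s'<s)

Hurwitz-scale : 0 < k → Hurwitz M (x * k) (y * k) (z * k) → Hurwitz (k * M) x y z
Hurwitz-scale {k@(suc _)} {M} {x} {y} {z} z<s h =
  *-cancelˡ-≡ _ _ (k * k) (trans (lhs k x y z) (trans h (rhs k M x y z)))
  where
  lhs : ∀ k x y z → k * k * (x * x + y * y + z * z)
                  ≡ (x * k) * (x * k) + (y * k) * (y * k) + (z * k) * (z * k)
  lhs = solve-∀
  rhs : ∀ k M x y z → M * (x * k) * (y * k) * (z * k) ≡ k * k * (k * M * x * y * z)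
  rhs = solve-∀

double≢3-mod-4 : ∀ t → (t * 2) % 4 ≢ 3
double≢3-mod-4 t h = 0≢1+n (begin
  0             ≡⟨ m*n%n≡0 t 2 ⟨
  t * 2 % 2     ≡⟨ m∣n⇒o%n%m≡o%m 2 4 (t * 2) (divides 2 refl) ⟨
  t * 2 % 4 % 2 ≡⟨ cong (_% 2) h ⟩
  1             ∎)
  where open ≡-Reasoning

squares≡double-mod-4⇒zero : ∀ ex ey ez t → ex < 2 → ey < 2 → ez < 2 →
  (ex * ex + ey * ey + ez * ez) % 4 ≡ (ex * ey * ez * t * 2) % 4 → ex ≡ 0 × ey ≡ 0 × ez ≡ 0
squares≡double-mod-4⇒zero 0 0 0 _ _ _ _ _ = refl , refl , refl
squares≡double-mod-4⇒zero 0 0 1 _ _ _ _ ()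
squares≡double-mod-4⇒zero 0 1 0 _ _ _ _ ()
squares≡double-mod-4⇒zero 0 1 1 _ _ _ _ ()
squares≡double-mod-4⇒zero 1 0 0 _ _ _ _ ()
squares≡double-mod-4⇒zero 1 0 1 _ _ _ _ ()
squares≡double-mod-4⇒zero 1 1 0 _ _ _ _ ()
squares≡double-mod-4⇒zero 1 1 1 t _ _ _ h = ⊥-elim (double≢3-mod-4 (t + 0) (sym h))
squares≡double-mod-4⇒zero (suc (suc _)) _ _ _ (s≤s (s≤s ())) _ _ _
squares≡double-mod-4⇒zero _ (suc (suc _)) _ _ _ (s≤s (s≤s ())) _ _
squares≡double-mod-4⇒zero _ _ (suc (suc _)) _ _ _ (s≤s (s≤s ())) _

Hurwitz-even-mod-4 : ∀ {ex ey ez px py pz} →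
  x ≡ ex + px * 2 → y ≡ ey + py * 2 → z ≡ ez + pz * 2 →
  Hurwitz (2 * m) x y z → (ex * ex + ey * ey + ez * ez) % 4 ≡ (ex * ey * ez * m * 2) % 4
Hurwitz-even-mod-4 {x} {y} {z} {m} {ex} {ey} {ez} {px} {py} {pz} refl refl refl h = begin
  (ex * ex + ey * ey + ez * ez) % 4
    ≡⟨ [m+kn]%n≡m%n (ex * ex + ey * ey + ez * ez) squares-carry 4 ⟨
  (ex * ex + ey * ey + ez * ez + squares-carry * 4) % 4
    ≡⟨ cong (_% 4) (squares ex ey ez px py pz) ⟨
  (x * x + y * y + z * z) % 4
    ≡⟨ cong (_% 4) h ⟩
  (2 * m * x * y * z) % 4
    ≡⟨ cong (_% 4) (product m ex ey ez px py pz) ⟩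
  (ex * ey * ez * m * 2 + product-carry * 4) % 4
    ≡⟨ [m+kn]%n≡m%n (ex * ey * ez * m * 2) product-carry 4 ⟩
  (ex * ey * ez * m * 2) % 4
    ∎
  where
  open ≡-Reasoning
  squares-carry product-carry : ℕ
  squares-carry = ex * px + px * px + ey * py + py * py + ez * pz + pz * pz
  product-carry = m * (px * ey * ez + ex * py * ez + ex * ey * pz)
                + 2 * m * (px * py * ez + px * ey * pz + ex * py * pz) + 4 * m * px * py * pz
  squares : ∀ ex ey ez px py pz →
    (ex + px * 2) * (ex + px * 2) + (ey + py * 2) * (ey + py * 2) + (ez + pz * 2) * (ez + pz * 2)
    ≡ ex * ex + ey * ey + ez * ez + (ex * px + px * px + ey * py + py * py + ez * pz + pz * pz) * 4
  squares = solve-∀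
  product : ∀ m ex ey ez px py pz →
    2 * m * (ex + px * 2) * (ey + py * 2) * (ez + pz * 2)
    ≡ ex * ey * ez * m * 2 + (m * (px * ey * ez + ex * py * ez + ex * ey * pz)
      + 2 * m * (px * py * ez + px * ey * pz + ex * py * pz) + 4 * m * px * py * pz) * 4
  product = solve-∀

Hurwitz-even⇒entries-even : Hurwitz (2 * m) x y z → 2 ∣ x × 2 ∣ y × 2 ∣ z
Hurwitz-even⇒entries-even {m} {x} {y} {z} h with
  squares≡double-mod-4⇒zero (x % 2) (y % 2) (z % 2) m (m%n<n x 2) (m%n<n y 2) (m%n<n z 2)
    (Hurwitz-even-mod-4 {m = m} {ex = x % 2} {y % 2} {z % 2} {x / 2} {y / 2} {z / 2}
      (m≡m%n+[m/n]*n x 2) (m≡m%n+[m/n]*n y 2) (m≡m%n+[m/n]*n z 2) h)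
... | x%2≡0 , y%2≡0 , z%2≡0 =
  m%n≡0⇒n∣m x 2 x%2≡0 , m%n≡0⇒n∣m y 2 y%2≡0 , m%n≡0⇒n∣m z 2 z%2≡0

halve : PositiveSolution (2 * m) → PositiveSolution (4 * m)
halve {m} (solution x y z x>0 y>0 z>0 h) with Hurwitz-even⇒entries-even {m} {x} {y} {z} h
... | divides x' refl , divides y' refl , divides z' refl =
  solution x' y' z' (m*n>0⇒m>0 x>0) (m*n>0⇒m>0 y>0) (m*n>0⇒m>0 z>0)
    (subst (λ n → Hurwitz n x' y' z') (sym (*-assoc 2 2 m)) (Hurwitz-scale {2} {2 * m} z<s h))

no-solution-0 : ¬ PositiveSolution 0
no-solution-0 (solution x y z x>0 _ _ h) =
  contradiction h (n>0⇒n≢0 (≤-trans (*-mono-≤ x>0 x>0)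
                                    (≤-trans (m≤m+n _ (y * y)) (m≤m+n _ (z * z)))))

no-solution-4 : ¬ PositiveSolution 4
no-solution-4 s = no-solution-≥5 (m≤m+n 5 3) (halve {2} s)

no-solution-2 : ¬ PositiveSolution 2
no-solution-2 s = no-solution-4 (halve {1} s)

hurwitz : PositiveSolution n → n ≡ 1 ⊎ n ≡ 3
hurwitz {0} s = contradiction s no-solution-0
hurwitz {1} _ = inj₁ refl
hurwitz {2} s = contradiction s no-solution-2
hurwitz {3} _ = inj₂ refl
hurwitz {4} s = contradiction s no-solution-4
hurwitz {suc (suc (suc (suc (suc k))))} s = contradiction s (no-solution-≥5 (m≤m+n 5 k))

∈⇒≤sumℕ : ∀ {t ts} → t ∈ ts → t ≤ sumℕ ts
∈⇒≤sumℕ {t} {_ ∷ ts} (here refl) = m≤m+n t (sumℕ ts)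
∈⇒≤sumℕ {t} {u ∷ ts} (there t∈ts) = ≤-trans (∈⇒≤sumℕ t∈ts) (m≤n+m (sumℕ ts) u)

sumℕ-zeros : ∀ {ts} → All (_≡ 0) ts → sumℕ ts ≡ 0
sumℕ-zeros [] = refl
sumℕ-zeros (refl ∷ ts≡0) = sumℕ-zeros ts≡0

module Evaluation (g : NPoly) (a b c : ℕ) where

  term : ℕ → ℕ → ℕ → ℕ
  term i j l = coeffN g i j l * a ^ i * b ^ j * c ^ l

  private
    range : List ℕ
    range = upTo (boundN g)

    terms-i : ℕ → List ℕ
    terms-i i = concatMap (λ j → map (term i j) range) range

    terms : List ℕ
    terms = concatMap terms-i range

    term∈terms : ∀ {i j l} → i < boundN g → j < boundN g → l < boundN g → term i j l ∈ terms
    term∈terms {i} {j} i<B j<B l<B =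
      ∈-concatMap⁺ terms-i (lose (∈-upTo⁺ i<B)
        (∈-concatMap⁺ (λ j → map (term i j) range)
          (lose (∈-upTo⁺ j<B) (∈-map⁺ (term i j) (∈-upTo⁺ l<B)))))

    ∈terms⇒term : ∀ {t} → t ∈ terms → ∃[ i ] ∃[ j ] ∃[ l ] t ≡ term i j l
    ∈terms⇒term t∈ with satisfied (∈-concatMap⁻ terms-i {xs = range} t∈)
    ... | i , t∈i with satisfied (∈-concatMap⁻ (λ j → map (term i j) range) {xs = range} t∈i)
    ... | j , t∈ij with ∈-map⁻ (term i j) t∈ij
    ... | l , _ , t≡ = i , j , l , t≡

  term≤evalN : ∀ i j l → coeffN g i j l ≢ 0 → term i j l ≤ evalN g a b c
  term≤evalN i j l coeff≢0 with supportN g i j l coeff≢0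
  ... | i<B , j<B , l<B = ∈⇒≤sumℕ (term∈terms i<B j<B l<B)

  evalN-zero : (∀ i j l → coeffN g i j l ≡ 0) → evalN g a b c ≡ 0
  evalN-zero coeff≡0 = sumℕ-zeros (All.tabulate λ t∈ → vanishes (∈terms⇒term t∈))
    where
    vanishes : ∀ {t} → ∃[ i ] ∃[ j ] ∃[ l ] t ≡ term i j l → t ≡ 0
    vanishes (i , j , l , t≡) rewrite coeff≡0 i j l = t≡

  evalN-positive : 0 < a → 0 < b → 0 < c → NonZeroPoly g → 0 < evalN g a b c
  evalN-positive a>0 b>0 c>0 (i , j , l , coeff≢0) = ≤-trans term>0 (term≤evalN i j l coeff≢0)
    where
    term>0 : 0 < term i j l
    term>0 = *-mono-≤ (*-mono-≤ (*-mono-≤ (n≢0⇒n>0 coeff≢0) (m^n>0 a {{>-nonZero a>0}} i))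
                                (m^n>0 b {{>-nonZero b>0}} j))
                      (m^n>0 c {{>-nonZero c>0}} l)

  module _ (a≥2 : 2 ≤ a) (b≥2 : 2 ≤ b) (c≥2 : 2 ≤ c) where

    private
      pow≥1 : ∀ {m} n → 2 ≤ m → 1 ≤ m ^ n
      pow≥1 {m@(suc _)} n _ = m^n>0 m n

      pow≥2 : ∀ {m} n → 2 ≤ m → 2 ≤ m ^ suc n
      pow≥2 n m≥2 = *-mono-≤ m≥2 (pow≥1 n m≥2)

    nonconstant-term≥2 : ∀ i j l → one-coeff i j l ≡ 0 → coeffN g i j l ≢ 0 → 2 ≤ term i j l
    nonconstant-term≥2 (suc i) j l _ coeff≢0 =
      *-mono-≤ (*-mono-≤ (*-mono-≤ (n≢0⇒n>0 coeff≢0) (pow≥2 i a≥2)) (pow≥1 j b≥2)) (pow≥1 l c≥2)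
    nonconstant-term≥2 zero (suc j) l _ coeff≢0 =
      *-mono-≤ (*-mono-≤ (*-mono-≤ (n≢0⇒n>0 coeff≢0) (pow≥1 0 a≥2)) (pow≥2 j b≥2)) (pow≥1 l c≥2)
    nonconstant-term≥2 zero zero (suc l) _ coeff≢0 =
      *-mono-≤ (*-mono-≤ (*-mono-≤ (n≢0⇒n>0 coeff≢0) (pow≥1 0 a≥2)) (pow≥1 0 b≥2)) (pow≥2 l c≥2)

    evalN≡1⇒IsOnePoly : evalN g a b c ≡ 1 → IsOnePoly g
    evalN≡1⇒IsOnePoly evalN≡1 i j l =
      trans (coeff≡const*one i j l) (trans (cong (_* one-coeff i j l) const≡1) (*-identityˡ _))
      where
      nonconstant≡0 : ∀ i j l → one-coeff i j l ≡ 0 → coeffN g i j l ≡ 0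
      nonconstant≡0 i j l one≡0 with coeffN g i j l ≟ 0
      ... | yes coeff≡0 = coeff≡0
      ... | no coeff≢0 = contradiction (subst (term i j l ≤_) evalN≡1 (term≤evalN i j l coeff≢0))
                                       (<⇒≱ (nonconstant-term≥2 i j l one≡0 coeff≢0))
      nonconstant≡const*0 : ∀ i j l → one-coeff i j l ≡ 0 → coeffN g i j l ≡ coeffN g 0 0 0 * 0
      nonconstant≡const*0 i j l one≡0 =
        trans (nonconstant≡0 i j l one≡0) (sym (*-zeroʳ (coeffN g 0 0 0)))
      coeff≡const*one : ∀ i j l → coeffN g i j l ≡ coeffN g 0 0 0 * one-coeff i j l
      coeff≡const*one zero    zero    zero    = sym (*-identityʳ _)
      coeff≡const*one (suc i) j       l       = nonconstant≡const*0 (suc i) j l refl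
      coeff≡const*one zero    (suc j) l       = nonconstant≡const*0 zero (suc j) l refl
      coeff≡const*one zero    zero    (suc l) = nonconstant≡const*0 zero zero (suc l) refl
      const≡1 : coeffN g 0 0 0 ≡ 1
      const≡1 with coeffN g 0 0 0 ≟ 0
      ... | yes const≡0 = contradiction (trans (sym evalN≡1) (evalN-zero λ i j l →
                            trans (coeff≡const*one i j l) (cong (_* one-coeff i j l) const≡0))) 1+n≢0
      ... | no const≢0 = ≤-antisym (subst₂ _≤_ (trailing-ones _) evalN≡1 (term≤evalN 0 0 0 const≢0))
                                   (n≢0⇒n>0 const≢0)
        where
        trailing-ones : ∀ u → u * 1 * 1 * 1 ≡ u
        trailing-ones = solve-∀

gcd3∣a : ∀ a b c → gcd3 a b c ∣ a
gcd3∣a a b c = ∣-trans (gcd[m,n]∣m (gcd a b) c) (gcd[m,n]∣m a b)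

gcd3∣b : ∀ a b c → gcd3 a b c ∣ b
gcd3∣b a b c = ∣-trans (gcd[m,n]∣m (gcd a b) c) (gcd[m,n]∣n a b)

gcd3∣c : ∀ a b c → gcd3 a b c ∣ c
gcd3∣c a b c = gcd[m,n]∣n (gcd a b) c

gcd3>0 : ∀ a b c → 0 < c → 0 < gcd3 a b c
gcd3>0 a b c c>0 = n≢0⇒n>0 (gcd[m,n]≢0 (gcd a b) c (inj₂ (n>0⇒n≢0 c>0)))

squares⇒Hurwitz : a ^ 2 + b ^ 2 + c ^ 2 ≡ a * b * c * M → Hurwitz M a b c
squares⇒Hurwitz {a} {b} {c} {M} h = trans (sym squares) (trans h (rhs a b c M))
  where
  square : ∀ u → u ^ 2 ≡ u * u
  square u = cong (u *_) (*-identityʳ u)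
  squares : a ^ 2 + b ^ 2 + c ^ 2 ≡ a * a + b * b + c * c
  squares = cong₂ _+_ (cong₂ _+_ (square a) (square b)) (square c)
  rhs : ∀ a b c M → a * b * c * M ≡ M * a * b * c
  rhs = solve-∀

primitive-solution : 0 < a → 0 < b → 0 < c → a ^ 2 + b ^ 2 + c ^ 2 ≡ a * b * c * M →
                     PositiveSolution (gcd3 a b c * M)
primitive-solution {a} {b} {c} {M} a>0 b>0 c>0 h
  with gcd3 a b c | gcd3>0 a b c c>0 | gcd3∣a a b c | gcd3∣b a b c | gcd3∣c a b c
... | k | k>0 | divides x refl | divides y refl | divides z refl =
  solution x y z (m*n>0⇒m>0 a>0) (m*n>0⇒m>0 b>0) (m*n>0⇒m>0 c>0)
    (Hurwitz-scale k>0 (squares⇒Hurwitz {x * k} {y * k} {z * k} h))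

+≡+*⇒multiple : ∀ L P F → 0 < P → ℤ.+ L ≡ ℤ.+ P ℤ.* F → ∃[ M ] L ≡ P * M
+≡+*⇒multiple L P (ℤ.+ M) _ h = M , +-injective (trans h (sym (pos-* P M)))
+≡+*⇒multiple L (suc P) ℤ.-[1+ M ] _ ()

∣3⇒≡1∨≡3 : k ∣ 3 → k ≡ 1 ⊎ k ≡ 3
∣3⇒≡1∨≡3 = prime⇒irreducible (from-yes (prime? 3))

gcd3≡1∨≡3 : 0 < a → 0 < b → 0 < c → a ^ 2 + b ^ 2 + c ^ 2 ≡ a * b * c * M →
            gcd3 a b c ≡ 1 ⊎ gcd3 a b c ≡ 3
gcd3≡1∨≡3 {a} {b} {c} {M} a>0 b>0 c>0 h with hurwitz (primitive-solution a>0 b>0 c>0 h)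
... | inj₁ kM≡1 = inj₁ (m*n≡1⇒m≡1 (gcd3 a b c) M kM≡1)
... | inj₂ kM≡3 = ∣3⇒≡1∨≡3 (divides M (trans (sym kM≡3) (*-comm (gcd3 a b c) M)))

coefficient≡3+G⇒G≡0 : ∀ {G} → 0 < a → 0 < b → 0 < c →
                       a ^ 2 + b ^ 2 + c ^ 2 ≡ a * b * c * (3 + G) → G ≡ 0
coefficient≡3+G⇒G≡0 {a} {b} {c} a>0 b>0 c>0 h
  with hurwitz (solution a b c a>0 b>0 c>0 (squares⇒Hurwitz {a} {b} {c} h))
... | inj₁ ()
... | inj₂ 3+G≡3 = +-cancelˡ-≡ 3 _ 0 3+G≡3

gcd3≡3⇒coefficient≡1 : 0 < a → 0 < b → 0 < c → a ^ 2 + b ^ 2 + c ^ 2 ≡ a * b * c * M →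
                       gcd3 a b c ≡ 3 → M ≡ 1
gcd3≡3⇒coefficient≡1 {a} {b} {c} {M} a>0 b>0 c>0 h k≡3
  with hurwitz (subst (λ k → PositiveSolution (k * M)) k≡3 (primitive-solution a>0 b>0 c>0 h))
... | inj₁ 3M≡1 = contradiction (m*n≡1⇒m≡1 3 M 3M≡1) λ ()
... | inj₂ 3M≡3 = *-cancelˡ-≡ M 1 3 3M≡3

gcd3≡3⇒entries≥2 : 0 < a → 0 < b → 0 < c → gcd3 a b c ≡ 3 → 2 ≤ a × 2 ≤ b × 2 ≤ c
gcd3≡3⇒entries≥2 {a} {b} {c} a>0 b>0 c>0 k≡3 =
  ≥2 a>0 (gcd3∣a a b c) , ≥2 b>0 (gcd3∣b a b c) , ≥2 c>0 (gcd3∣c a b c)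
  where
  ≥2 : ∀ {u} → 0 < u → gcd3 a b c ∣ u → 2 ≤ u
  ≥2 u>0 k∣u = <⇒≤ (subst (_≤ _) k≡3 (∣⇒≤ {{>-nonZero u>0}} k∣u))

corollary1 :
  ((f : ZPoly) (a b c : ℕ) → 0 < a → 0 < b → 0 < c →
    ¬ ((ℤ.+ (a ^ 2 + b ^ 2 + c ^ 2)
          ≡ ℤ.+ (a * b * c) ℤ.* evalZ f (ℤ.+ a) (ℤ.+ b) (ℤ.+ c))
       × gcd3 a b c ≢ 1 × gcd3 a b c ≢ 3))
  × ((g : NPoly) → NonZeroPoly g → (a b c : ℕ) → 0 < a → 0 < b → 0 < c →
    ¬ ((a ^ 2 + b ^ 2 + c ^ 2 ≡ a * b * c * (3 + evalN g a b c))
       × gcd3 a b c ≡ 1))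
  × ((g : NPoly) → ¬ IsOnePoly g → (a b c : ℕ) → 0 < a → 0 < b → 0 < c →
    ¬ ((a ^ 2 + b ^ 2 + c ^ 2 ≡ a * b * c * evalN g a b c)
       × gcd3 a b c ≡ 3))
corollary1 =
  (λ f a b c a>0 b>0 c>0 (h , k≢1 , k≢3) →
    let M , h′ = +≡+*⇒multiple _ (a * b * c) _ (product>0 a>0 b>0 c>0) h
    in [ k≢1 , k≢3 ] (gcd3≡1∨≡3 a>0 b>0 c>0 h′)) ,
  -- Part (2) does not need gcd(a,b,c) = 1.
  (λ g g≢0 a b c a>0 b>0 c>0 (h , _) →
    n>0⇒n≢0 (Evaluation.evalN-positive g a b c a>0 b>0 c>0 g≢0)
            (coefficient≡3+G⇒G≡0 a>0 b>0 c>0 h)) ,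
  (λ g g≢1 a b c a>0 b>0 c>0 (h , k≡3) →
    let a≥2 , b≥2 , c≥2 = gcd3≡3⇒entries≥2 a>0 b>0 c>0 k≡3
    in g≢1 (Evaluation.evalN≡1⇒IsOnePoly g a b c a≥2 b≥2 c≥2
              (gcd3≡3⇒coefficient≡1 a>0 b>0 c>0 h k≡3)))
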